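{- For the Dense Ranking algorithm described below, the estimated ranks $\tilde r(a_1),\dots,\tilde r(a_n)$ are independent and each is uniformly distributed on $[n]$.
   Context: Setting: $n$ elements with distinct values from a totally ordered set arrive online in uniformly random order; $a_t$ is the element arriving at time $t$. Dense Ranking algorithm (on $n$ positions): at time $t$, let $r_t=|\{t'<t: a_{t'}<a_t\}|$; sample $x_t$ uniformly from the real interval $[r_t\frac{n}{t},(r_t+1)\frac{n}{t}]$ (independently of everything else) and set the estimated rank $\tilde r(a_t)=\lceil x_t\rceil$. Randomness is over the arrival order and the algorithm's sampling. -}

module Defs where

open import Data.Nat using (ℕ; zero; suc; _+_; _*_; _∸_; _⊔_; _⊓_)
open import Data.Fin using (Fin; zero; suc; toℕ; _<_)
open import Data.Fin.Properties using (all?; _<?_) renaming (_≟_ to _≟ᶠ_)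
open import Data.Vec.Functional using () renaming (_∷_ to _∷ᶠ_)
open import Data.List using (List; []; _∷_; [_]; map; concatMap; filter; length; allFin; foldr)
open import Data.Product using (_×_)
open import Data.Integer using (+_)
open import Data.Rational using (ℚ; _/_; 0ℚ; 1ℚ) renaming (_+_ to _+ℚ_; _*_ to _*ℚ_)
open import Relation.Binary.PropositionalEquality using (_≡_)
open import Relation.Nullary using (Dec)
open import Relation.Nullary.Decidable using (_→-dec_; _×-dec_)

allFuns : (n m : ℕ) → List (Fin n → Fin m)
allFuns zero    m = [ (λ ()) ]
allFuns (suc n) m = concatMap (λ f → map (λ j → j ∷ᶠ f) (allFin m)) (allFuns n m)

injective? : ∀ {n} (σ : Fin n → Fin n) → Dec (∀ i j → σ i ≡ σ j → i ≡ j)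
injective? σ = all? (λ i → all? (λ j → (σ i ≟ᶠ σ j) →-dec (i ≟ᶠ j)))

-- All arrival orders: σ i = (0-based) true rank of the element arriving at time i+1.
-- Since values are distinct and only comparisons matter, the elements are WLOG 0,…,n-1
-- and a uniformly random arrival order is a uniformly random permutation.
perms : (n : ℕ) → List (Fin n → Fin n)
perms n = filter injective? (allFuns n n)

-- r_t for the element arriving at (0-based) time i: number of earlier elements smaller than it.
relRank : ∀ {n} → (Fin n → Fin n) → Fin n → ℕ
relRank {n} σ i = length (filter (λ j → (j <? i) ×-dec (σ j <? σ i)) (allFin n))

-- Pr[ ⌈x⌉ = k ] for x uniform on [r n / t , (r+1) n / t] (t ≥ 1, n ≥ 1):
-- length([r n/t,(r+1)n/t] ∩ [k-1,k]) / (n/t)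
--   = ( min((r+1) n, k t) − max(r n, (k-1) t) )⁺ / n .
ceilProb : (n t r k : ℕ) → ℚ
ceilProb zero    t r k = 0ℚ
ceilProb (suc m) t r k =
  (+ ((((suc r) * suc m) ⊓ (k * t)) ∸ ((r * suc m) ⊔ ((k ∸ 1) * t)))) / suc m

sumℚ prodℚ : List ℚ → ℚ
sumℚ  = foldr _+ℚ_ 0ℚ
prodℚ = foldr _*ℚ_ 1ℚ

avg : List ℚ → ℚ
avg []       = 0ℚ
avg (x ∷ xs) = sumℚ (x ∷ xs) *ℚ ((+ 1) / suc (length xs))

-- Pr[ r̃(a_t) = k t + 1 for all t ] (ranks in [n] encoded as Fin n, value toℕ + 1):
-- average over uniformly random arrival orders of the product over times t = i+1
-- of the independent sampling probabilities.
jointProb : (n : ℕ) → (Fin n → Fin n) → ℚ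
jointProb n k =
  avg (map (λ σ → prodℚ (map (λ i → ceilProb n (suc (toℕ i)) (relRank σ i) (suc (toℕ (k i))))
                             (allFin n)))
           (perms n))

{-# OPTIONS --safe #-}
module Submission where

-- A permutation σ of Fin (suc n) is determined by its last value v and the permutation τ of Fin n
-- with σ = (punchIn v ∘ τ) ∷ʳ v.  The last arrival has relative rank toℕ v, and every earlier arrival
-- has the same relative rank in σ as in τ.  So the relative ranks (r₀, …, rₙ₋₁) of the permutations
-- run exactly once through the sequences with rᵢ ≤ i (the Lehmer code), and in any commutative
-- semiring a sum over permutations of ∏ᵢ gᵢ(rᵢ) factorises as ∏ᵢ ∑_{r ≤ i} gᵢ(r); over ℕ with g = 1
-- this counts the n! permutations.
-- For fixed t and k the intervals [r n/t, (r+1) n/t], r < t, tile [0, n], so summing Pr[⌈x⌉ = k]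
-- over r < t gives |[k-1, k]| / (n/t) = t/n.  The joint probability is therefore (1/n!) ∏ₜ t/n = 1/nⁿ.

open import Defs
open import Algebra.Bundles using (CommutativeSemigroup)
open import Algebra.Core using (Op₂)
open import Algebra.Structures using (IsCommutativeMonoid; IsCommutativeSemiring; IsCommutativeRing)
open import Data.Bool using (if_then_else_)
open import Data.Empty using (⊥-elim)
open import Data.Fin as Fin using (Fin; zero; suc; toℕ; fromℕ; punchIn; punchOut)
open import Data.Fin.Properties
  using (all?; _<?_; _≟_; toℕ<n; toℕ-fromℕ; 0≢1+n; suc-injective; punchInᵢ≢i; punchIn-injective;
         punchIn-mono-≤; punchIn-cancel-≤; punchIn-punchOut; punchOut-injective)
open import Data.Integer as ℤ using (+_)
import Data.Integer.Properties as ℤP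
open import Data.List using (List; []; _∷_; _++_; map; concatMap; filter; foldr; length; allFin)
open import Data.List.Properties using (map-tabulate; length-tabulate; length-map)
open import Data.Nat as ℕ using (ℕ; zero; suc; _∸_; _⊓_; _⊔_; _≤_; _!; _^_; NonZero; ≢-nonZero⁻¹)
import Data.Nat.Properties as ℕP
open import Data.Nat.Properties using (m*n≢0; m^n≢0; _!≢0)
open import Data.Product using (_×_; _,_)
open import Data.Rational as ℚ using (ℚ; _/_; fromℚᵘ; toℚᵘ)
import Data.Rational.Properties as ℚP
open import Data.Rational.Properties
  using (fromℚᵘ-cong; fromℚᵘ-toℚᵘ; toℚᵘ-fromℚᵘ; toℚᵘ-homo-+; toℚᵘ-homo-*)
open import Data.Rational.Unnormalised as ℚᵘ using (mkℚᵘ; *≡*)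
import Data.Rational.Unnormalised.Properties as ℚᵘP
open import Data.Vec.Functional using (Vector; insertAt) renaming (_∷_ to _∷ᶠ_)
open import Data.Vec.Functional.Properties using (insertAt-lookup; insertAt-punchIn; removeAt-punchOut)
open import Function using (_∘_; id; _⇔_; mk⇔; Equivalence)
open import Function.Definitions using (Injective)
open import Relation.Binary.PropositionalEquality
open import Relation.Nullary using (Dec; yes; no; does; ¬_; contradiction; ¬?; map′)
open import Relation.Nullary.Decidable using (_×-dec_; _→-dec_)

punchIn-mono-< : ∀ {n} (i : Fin (suc n)) {j k : Fin n} → j Fin.< k → punchIn i j Fin.< punchIn i k
punchIn-mono-< i {j} {k} j<k = ℕP.≰⇒> (ℕP.<⇒≱ j<k ∘ punchIn-cancel-≤ i k j)

punchIn-cancel-< : ∀ {n} (i : Fin (suc n)) {j k : Fin n} → punchIn i j Fin.< punchIn i k → j Fin.< k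
punchIn-cancel-< i {j} {k} ij<ik = ℕP.≰⇒> (ℕP.<⇒≱ ij<ik ∘ punchIn-mono-≤ i k j)

toℕ-punchIn-fromℕ : ∀ {n} (j : Fin n) → toℕ (punchIn (fromℕ n) j) ≡ toℕ j
toℕ-punchIn-fromℕ zero    = refl
toℕ-punchIn-fromℕ (suc j) = cong suc (toℕ-punchIn-fromℕ j)

punchIn-fromℕ-< : ∀ {n} (j : Fin n) → punchIn (fromℕ n) j Fin.< fromℕ n
punchIn-fromℕ-< {n} j = subst₂ ℕ._<_ (sym (toℕ-punchIn-fromℕ j)) (sym (toℕ-fromℕ n)) (toℕ<n j)

module BigOp {A : Set} {_∙_ : Op₂ A} {ε : A} (M : IsCommutativeMonoid _≡_ _∙_ ε) where

  open IsCommutativeMonoid M using (assoc; identityˡ; isCommutativeSemigroup)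

  private
    commutativeSemigroup : CommutativeSemigroup _ _
    commutativeSemigroup = record { isCommutativeSemigroup = isCommutativeSemigroup }

  open import Algebra.Properties.CommutativeSemigroup commutativeSemigroup using (interchange; x∙yz≈y∙xz)

  foldMap : {B : Set} → (B → A) → List B → A
  foldMap f xs = foldr _∙_ ε (map f xs)

  foldMap< : ℕ → (ℕ → A) → A
  foldMap< t h = foldMap (h ∘ toℕ) (allFin t)

  when : {P : Set} → Dec P → A → A
  when d x = if does d then x else ε

  foldMap-cong : {B : Set} {f g : B → A} → f ≗ g → (xs : List B) → foldMap f xs ≡ foldMap g xs
  foldMap-cong f≗g []       = refl
  foldMap-cong f≗g (x ∷ xs) = cong₂ _∙_ (f≗g x) (foldMap-cong f≗g xs)

  foldMap-ε : {B : Set} (xs : List B) → foldMap (λ _ → ε) xs ≡ ε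
  foldMap-ε []       = refl
  foldMap-ε (x ∷ xs) = trans (identityˡ _) (foldMap-ε xs)

  foldMap-++ : {B : Set} (f : B → A) (xs ys : List B) → foldMap f (xs ++ ys) ≡ foldMap f xs ∙ foldMap f ys
  foldMap-++ f []       ys = sym (identityˡ _)
  foldMap-++ f (x ∷ xs) ys = trans (cong (f x ∙_) (foldMap-++ f xs ys)) (sym (assoc _ _ _))

  foldMap-∙ : {B : Set} (f g : B → A) (xs : List B) → foldMap (λ x → f x ∙ g x) xs ≡ foldMap f xs ∙ foldMap g xs
  foldMap-∙ f g []       = sym (identityˡ ε)
  foldMap-∙ f g (x ∷ xs) = trans (cong ((f x ∙ g x) ∙_) (foldMap-∙ f g xs)) (interchange _ _ _ _)

  foldMap-map : {B C : Set} (f : C → A) (g : B → C) (xs : List B) → foldMap f (map g xs) ≡ foldMap (f ∘ g) xs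
  foldMap-map f g []       = refl
  foldMap-map f g (x ∷ xs) = cong (f (g x) ∙_) (foldMap-map f g xs)

  foldMap-concatMap : {B C : Set} (f : C → A) (g : B → List C) (xs : List B) →
                      foldMap f (concatMap g xs) ≡ foldMap (foldMap f ∘ g) xs
  foldMap-concatMap f g []       = refl
  foldMap-concatMap f g (x ∷ xs) =
    trans (foldMap-++ f (g x) (concatMap g xs)) (cong (foldMap f (g x) ∙_) (foldMap-concatMap f g xs))

  foldMap-comm : {B C : Set} (f : B → C → A) (xs : List B) (ys : List C) →
                 foldMap (λ x → foldMap (f x) ys) xs ≡ foldMap (λ y → foldMap (λ x → f x y) xs) ys
  foldMap-comm f []       ys = sym (foldMap-ε ys)
  foldMap-comm f (x ∷ xs) ys = trans (cong (foldMap (f x) ys ∙_) (foldMap-comm f xs ys))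
                                     (sym (foldMap-∙ (f x) (λ y → foldMap (λ x → f x y) xs) ys))

  foldMap-filter : {B : Set} {P : B → Set} (P? : ∀ x → Dec (P x)) (f : B → A) (xs : List B) →
                   foldMap f (filter P? xs) ≡ foldMap (λ x → when (P? x) (f x)) xs
  foldMap-filter P? f []       = refl
  foldMap-filter P? f (x ∷ xs) with P? x
  ... | yes _ = cong (f x ∙_) (foldMap-filter P? f xs)
  ... | no  _ = trans (foldMap-filter P? f xs) (sym (identityˡ _))

  when-yes : {P : Set} → P → (d : Dec P) (x : A) → when d x ≡ x
  when-yes p (yes _) x = refl
  when-yes p (no ¬p) x = contradiction p ¬p

  when-no : {P : Set} → ¬ P → (d : Dec P) (x : A) → when d x ≡ ε
  when-no ¬p (yes p) x = contradiction p ¬p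
  when-no ¬p (no _)  x = refl

  when-⇔ : {P Q : Set} → P ⇔ Q → (d : Dec P) (e : Dec Q) (x : A) → when d x ≡ when e x
  when-⇔ P⇔Q (yes p) e x = sym (when-yes (Equivalence.to P⇔Q p) e x)
  when-⇔ P⇔Q (no ¬p) e x = sym (when-no (¬p ∘ Equivalence.from P⇔Q) e x)

  when-×-dec : {P Q : Set} (d : Dec P) (e : Dec Q) (x : A) → when (d ×-dec e) x ≡ when d (when e x)
  when-×-dec (yes _) (yes _) x = refl
  when-×-dec (yes _) (no _)  x = refl
  when-×-dec (no _)  e       x = refl

  when-cong : {P : Set} (d : Dec P) {x y : A} → (P → x ≡ y) → when d x ≡ when d y
  when-cong (yes p) x≡y = x≡y p
  when-cong (no _)  x≡y = refl

  foldMap-when : {B P : Set} (d : Dec P) (f : B → A) (xs : List B) →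
                 foldMap (λ x → when d (f x)) xs ≡ when d (foldMap f xs)
  foldMap-when (yes _) f xs = refl
  foldMap-when (no _)  f xs = foldMap-ε xs

  foldMap-allFin-suc : ∀ n (f : Fin (suc n) → A) → foldMap f (allFin (suc n)) ≡ f zero ∙ foldMap (f ∘ suc) (allFin n)
  foldMap-allFin-suc n f = cong (λ ys → f zero ∙ foldr _∙_ ε ys)
    (trans (map-tabulate suc f) (sym (map-tabulate id (f ∘ suc))))

  foldMap-punchIn : ∀ n (v : Fin (suc n)) (f : Fin (suc n) → A) →
                    foldMap f (allFin (suc n)) ≡ f v ∙ foldMap (f ∘ punchIn v) (allFin n)
  foldMap-punchIn n       zero    f = foldMap-allFin-suc n f
  foldMap-punchIn (suc n) (suc v) f = begin
    foldMap f (allFin (suc (suc n)))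
      ≡⟨ foldMap-allFin-suc (suc n) f ⟩
    f zero ∙ foldMap (f ∘ suc) (allFin (suc n))
      ≡⟨ cong (f zero ∙_) (foldMap-punchIn n v (f ∘ suc)) ⟩
    f zero ∙ (f (suc v) ∙ foldMap (f ∘ suc ∘ punchIn v) (allFin n))
      ≡⟨ x∙yz≈y∙xz _ _ _ ⟩
    f (suc v) ∙ (f zero ∙ foldMap (f ∘ suc ∘ punchIn v) (allFin n))
      ≡⟨ cong (f (suc v) ∙_) (foldMap-allFin-suc n (f ∘ punchIn (suc v))) ⟨
    f (suc v) ∙ foldMap (f ∘ punchIn (suc v)) (allFin (suc n))
      ∎
    where open ≡-Reasoning

  foldMap-injective : ∀ n (τ : Fin n → Fin n) → Injective _≡_ _≡_ τ → (f : Fin n → A) →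
                      foldMap (f ∘ τ) (allFin n) ≡ foldMap f (allFin n)
  foldMap-injective zero    τ τ-inj f = refl
  foldMap-injective (suc n) τ τ-inj f = begin
    foldMap (f ∘ τ) (allFin (suc n))
      ≡⟨ foldMap-allFin-suc n (f ∘ τ) ⟩
    f v ∙ foldMap (f ∘ τ ∘ suc) (allFin n)
      ≡⟨ cong (f v ∙_) (foldMap-cong (cong f ∘ τ-suc) (allFin n)) ⟨
    f v ∙ foldMap (f ∘ punchIn v ∘ τ′) (allFin n)
      ≡⟨ cong (f v ∙_) (foldMap-injective n τ′ τ′-inj (f ∘ punchIn v)) ⟩
    f v ∙ foldMap (f ∘ punchIn v) (allFin n)
      ≡⟨ foldMap-punchIn n v f ⟨
    foldMap f (allFin (suc n))
      ∎
    where
    open ≡-Reasoning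
    v = τ zero
    v≢τsuc : ∀ i → v ≢ τ (suc i)
    v≢τsuc i eq = 0≢1+n (τ-inj eq)
    τ′ : Fin n → Fin n
    τ′ i = punchOut (v≢τsuc i)
    τ-suc : ∀ i → punchIn v (τ′ i) ≡ τ (suc i)
    τ-suc i = punchIn-punchOut (v≢τsuc i)
    τ′-inj : Injective _≡_ _≡_ τ′
    τ′-inj eq = suc-injective (τ-inj (punchOut-injective (v≢τsuc _) (v≢τsuc _) eq))

  foldMap-when-≢ : ∀ n (v : Fin (suc n)) (f : Fin (suc n) → A) →
                   foldMap (λ j → when (¬? (j ≟ v)) (f j)) (allFin (suc n)) ≡ foldMap (f ∘ punchIn v) (allFin n)
  foldMap-when-≢ n v f = begin
    foldMap (λ j → when (¬? (j ≟ v)) (f j)) (allFin (suc n))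
      ≡⟨ foldMap-punchIn n v _ ⟩
    when (¬? (v ≟ v)) (f v) ∙ foldMap (λ j → when (¬? (punchIn v j ≟ v)) (f (punchIn v j))) (allFin n)
      ≡⟨ cong₂ _∙_ (when-no (λ v≢v → v≢v refl) (¬? (v ≟ v)) (f v)) (foldMap-cong ≢v (allFin n)) ⟩
    ε ∙ foldMap (f ∘ punchIn v) (allFin n)
      ≡⟨ identityˡ _ ⟩
    foldMap (f ∘ punchIn v) (allFin n)
      ∎
    where
    open ≡-Reasoning
    ≢v : ∀ j → when (¬? (punchIn v j ≟ v)) (f (punchIn v j)) ≡ f (punchIn v j)
    ≢v j = when-yes (punchInᵢ≢i v j) (¬? (punchIn v j ≟ v)) (f (punchIn v j))

  foldMap<-suc : ∀ t (h : ℕ → A) → foldMap< (suc t) h ≡ h t ∙ foldMap< t h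
  foldMap<-suc t h = trans (foldMap-punchIn t (fromℕ t) (h ∘ toℕ))
    (cong₂ _∙_ (cong h (toℕ-fromℕ t)) (foldMap-cong (cong h ∘ toℕ-punchIn-fromℕ) (allFin t)))

module ∑ℕ = BigOp ℕP.+-0-isCommutativeMonoid
module ∏ℕ = BigOp ℕP.*-1-isCommutativeMonoid

count : ∀ {B : Set} {P : B → Set} → (∀ x → Dec (P x)) → List B → ℕ
count P? = ∑ℕ.foldMap (λ x → ∑ℕ.when (P? x) 1)

length-filter : ∀ {B : Set} {P : B → Set} (P? : ∀ x → Dec (P x)) (xs : List B) → length (filter P? xs) ≡ count P? xs
length-filter P? []       = refl
length-filter P? (x ∷ xs) with P? x
... | yes _ = cong suc (length-filter P? xs)
... | no  _ = length-filter P? xs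

length≡∑1 : ∀ {B : Set} (xs : List B) → length xs ≡ ∑ℕ.foldMap (λ _ → 1) xs
length≡∑1 []       = refl
length≡∑1 (x ∷ xs) = cong suc (length≡∑1 xs)

count-⇔ : ∀ {B : Set} {P Q : B → Set} (P? : ∀ x → Dec (P x)) (Q? : ∀ x → Dec (Q x)) →
          (∀ x → P x ⇔ Q x) → (xs : List B) → count P? xs ≡ count Q? xs
count-⇔ P? Q? P⇔Q = ∑ℕ.foldMap-cong (λ x → ∑ℕ.when-⇔ (P⇔Q x) (P? x) (Q? x) 1)

_∷ʳ_ : ∀ {A : Set} {n} → Vector A n → A → Vector A (suc n)
f ∷ʳ v = insertAt f (fromℕ _) v

∷ᶠ-cong : ∀ {A : Set} {n} (x : A) {f g : Vector A n} → f ≗ g → (x ∷ᶠ f) ≗ (x ∷ᶠ g)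
∷ᶠ-cong x f≗g zero    = refl
∷ᶠ-cong x f≗g (suc i) = f≗g i

insertAt-cong : ∀ {A : Set} {n} {f g : Vector A n} (p : Fin (suc n)) (v : A) → f ≗ g → insertAt f p v ≗ insertAt g p v
insertAt-cong             zero    v f≗g zero    = refl
insertAt-cong             zero    v f≗g (suc j) = f≗g j
insertAt-cong {n = suc n} (suc p) v f≗g zero    = f≗g zero
insertAt-cong {n = suc n} (suc p) v f≗g (suc j) = insertAt-cong p v (f≗g ∘ suc) j

insertAt-punchOut : ∀ {A : Set} {n} (f : Vector A n) {p x : Fin (suc n)} (v : A) (p≢x : p ≢ x) →
                    insertAt f p v x ≡ f (punchOut p≢x)
insertAt-punchOut f {p} v p≢x =
  trans (sym (removeAt-punchOut (insertAt f p v) p≢x)) (insertAt-punchIn f p v (punchOut p≢x))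

Avoids : ∀ {n m} → Fin m → (Fin n → Fin m) → Set
Avoids v f = ∀ i → f i ≢ v

avoids? : ∀ {n m} (v : Fin m) (f : Fin n → Fin m) → Dec (Avoids v f)
avoids? v f = all? (λ i → ¬? (f i ≟ v))

inj? : ∀ {n m} (f : Fin n → Fin m) → Dec (Injective _≡_ _≡_ f)
inj? f = map′ (λ inj {i} {j} → inj i j) (λ inj i j → inj) (all? λ i → all? λ j → (f i ≟ f j) →-dec (i ≟ j))

module _ {n m : ℕ} where

  injective-≗ : {f g : Fin n → Fin m} → f ≗ g → Injective _≡_ _≡_ f ⇔ Injective _≡_ _≡_ g
  injective-≗ f≗g = mk⇔ (transport f≗g) (transport (sym ∘ f≗g))
    where
    transport : {f g : Fin n → Fin m} → f ≗ g → Injective _≡_ _≡_ f → Injective _≡_ _≡_ g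
    transport f≗g f-inj {i} {j} gi≡gj = f-inj (trans (f≗g i) (trans gi≡gj (sym (f≗g j))))

  punchIn-∘-injective⇔ : (v : Fin (suc m)) (τ : Fin n → Fin m) →
                         Injective _≡_ _≡_ (punchIn v ∘ τ) ⇔ Injective _≡_ _≡_ τ
  punchIn-∘-injective⇔ v τ = mk⇔ (λ inj {i} {j} eq → inj {i} {j} (cong (punchIn v) eq))
                                 (λ τ-inj {i} {j} eq → τ-inj (punchIn-injective v (τ i) (τ j) eq))

  insertAt-injective⇔ : (f : Fin n → Fin m) (p : Fin (suc n)) (v : Fin m) →
                        Injective _≡_ _≡_ (insertAt f p v) ⇔ (Avoids v f × Injective _≡_ _≡_ f)
  insertAt-injective⇔ f p v = mk⇔ to from
    where
    at-p : insertAt f p v p ≡ v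
    at-p = insertAt-lookup f p v
    at-punchIn : ∀ i → insertAt f p v (punchIn p i) ≡ f i
    at-punchIn = insertAt-punchIn f p v
    to : Injective _≡_ _≡_ (insertAt f p v) → Avoids v f × Injective _≡_ _≡_ f
    to inj = (λ i fi≡v → punchInᵢ≢i p i (inj (trans (at-punchIn i) (trans fi≡v (sym at-p))))) ,
             (λ {i} {j} fi≡fj → punchIn-injective p i j (inj (trans (at-punchIn i) (trans fi≡fj (sym (at-punchIn j))))))
    from : Avoids v f × Injective _≡_ _≡_ f → Injective _≡_ _≡_ (insertAt f p v)
    from (f-avoids , f-inj) {x} {y} eq with p ≟ x | p ≟ y
    ... | yes refl | yes refl = refl
    ... | yes refl | no p≢y   = contradiction (sym (trans (sym at-p) (trans eq (insertAt-punchOut f v p≢y))))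
                                              (f-avoids (punchOut p≢y))
    ... | no p≢x   | yes refl = contradiction (sym (trans (sym at-p) (trans (sym eq) (insertAt-punchOut f v p≢x))))
                                              (f-avoids (punchOut p≢x))
    ... | no p≢x   | no p≢y   = punchOut-injective p≢x p≢y
                                  (f-inj (trans (sym (insertAt-punchOut f v p≢x)) (trans eq (insertAt-punchOut f v p≢y))))

EarlierSmaller : ∀ {n m} → (Fin n → Fin m) → Fin n → Fin n → Set
EarlierSmaller f i j = j Fin.< i × f j Fin.< f i

earlierSmaller? : ∀ {n m} (f : Fin n → Fin m) (i j : Fin n) → Dec (EarlierSmaller f i j)
earlierSmaller? f i j = (j <? i) ×-dec (f j <? f i)

relativeRank : ∀ {n m} → (Fin n → Fin m) → Fin n → ℕ
relativeRank {n} f i = length (filter (earlierSmaller? f i) (allFin n))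

relativeRank-⇔ : ∀ {n m m′} (f : Fin n → Fin m) (g : Fin n → Fin m′) (i i′ : Fin n) →
                 (∀ j → EarlierSmaller f i j ⇔ EarlierSmaller g i′ j) → relativeRank f i ≡ relativeRank g i′
relativeRank-⇔ {n} f g i i′ f⇔g = begin
  relativeRank f i                           ≡⟨ length-filter (earlierSmaller? f i) (allFin n) ⟩
  count (earlierSmaller? f i) (allFin n)     ≡⟨ count-⇔ (earlierSmaller? f i) (earlierSmaller? g i′) f⇔g (allFin n) ⟩
  count (earlierSmaller? g i′) (allFin n)    ≡⟨ length-filter (earlierSmaller? g i′) (allFin n) ⟨
  relativeRank g i′                          ∎
  where open ≡-Reasoning

module _ {n m : ℕ} where

  relativeRank-cong : {f g : Fin n → Fin m} → f ≗ g → ∀ i → relativeRank f i ≡ relativeRank g i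
  relativeRank-cong {f} {g} f≗g i = relativeRank-⇔ f g i i (λ j → mk⇔
    (λ (j<i , fj<fi) → j<i , subst₂ Fin._<_ (f≗g j) (f≗g i) fj<fi)
    (λ (j<i , gj<gi) → j<i , subst₂ Fin._<_ (sym (f≗g j)) (sym (f≗g i)) gj<gi))

  relativeRank-punchIn-∘ : (v : Fin (suc m)) (f : Fin n → Fin m) (i : Fin n) →
                           relativeRank (punchIn v ∘ f) i ≡ relativeRank f i
  relativeRank-punchIn-∘ v f i = relativeRank-⇔ (punchIn v ∘ f) f i i (λ j → mk⇔
    (λ (j<i , vfj<vfi) → j<i , punchIn-cancel-< v vfj<vfi)
    (λ (j<i , fj<fi) → j<i , punchIn-mono-< v fj<fi))

  relativeRank-split-last : (g : Fin (suc n) → Fin m) (x : Fin (suc n)) →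
    relativeRank g x
      ≡ ∑ℕ.when (earlierSmaller? g x (fromℕ n)) 1 ℕ.+ count (earlierSmaller? g x ∘ punchIn (fromℕ n)) (allFin n)
  relativeRank-split-last g x =
    trans (length-filter (earlierSmaller? g x) (allFin (suc n))) (∑ℕ.foldMap-punchIn n (fromℕ n) _)

  relativeRank-∷ʳ-punchIn : (f : Fin n → Fin m) (v : Fin m) (i : Fin n) →
                            relativeRank (f ∷ʳ v) (punchIn (fromℕ n) i) ≡ relativeRank f i
  relativeRank-∷ʳ-punchIn f v i = begin
    relativeRank (f ∷ʳ v) x
      ≡⟨ relativeRank-split-last (f ∷ʳ v) x ⟩
    ∑ℕ.when (earlierSmaller? (f ∷ʳ v) x last) 1
      ℕ.+ count (earlierSmaller? (f ∷ʳ v) x ∘ punchIn last) (allFin n)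
      ≡⟨ cong₂ ℕ._+_ (∑ℕ.when-no last≮x (earlierSmaller? (f ∷ʳ v) x last) 1)
                     (count-⇔ (earlierSmaller? (f ∷ʳ v) x ∘ punchIn last) (earlierSmaller? f i) earlier⇔ (allFin n)) ⟩
    count (earlierSmaller? f i) (allFin n)
      ≡⟨ length-filter (earlierSmaller? f i) (allFin n) ⟨
    relativeRank f i
      ∎
    where
    open ≡-Reasoning
    last = fromℕ n
    x = punchIn last i
    at = insertAt-punchIn f last v
    last≮x : ¬ EarlierSmaller (f ∷ʳ v) x last
    last≮x (last<x , _) = ℕP.<-asym last<x (punchIn-fromℕ-< i)
    earlier⇔ : ∀ j → EarlierSmaller (f ∷ʳ v) x (punchIn last j) ⇔ EarlierSmaller f i j
    earlier⇔ j = mk⇔ (λ (j<i , <) → punchIn-cancel-< last j<i , subst₂ Fin._<_ (at j) (at i) <)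
                     (λ (j<i , <) → punchIn-mono-< last j<i , subst₂ Fin._<_ (sym (at j)) (sym (at i)) <)

  relativeRank-∷ʳ-fromℕ : (f : Fin n → Fin m) (v : Fin m) →
                          relativeRank (f ∷ʳ v) (fromℕ n) ≡ count (λ j → f j <? v) (allFin n)
  relativeRank-∷ʳ-fromℕ f v = begin
    relativeRank (f ∷ʳ v) last
      ≡⟨ relativeRank-split-last (f ∷ʳ v) last ⟩
    ∑ℕ.when (earlierSmaller? (f ∷ʳ v) last last) 1
      ℕ.+ count (earlierSmaller? (f ∷ʳ v) last ∘ punchIn last) (allFin n)
      ≡⟨ cong₂ ℕ._+_ (∑ℕ.when-no last≮last (earlierSmaller? (f ∷ʳ v) last last) 1)
                     (count-⇔ (earlierSmaller? (f ∷ʳ v) last ∘ punchIn last) (λ j → f j <? v) earlier⇔ (allFin n)) ⟩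
    count (λ j → f j <? v) (allFin n)
      ∎
    where
    open ≡-Reasoning
    last = fromℕ n
    at = insertAt-punchIn f last v
    last≮last : ¬ EarlierSmaller (f ∷ʳ v) last last
    last≮last (last<last , _) = ℕP.<-irrefl refl last<last
    earlier⇔ : ∀ j → EarlierSmaller (f ∷ʳ v) last (punchIn last j) ⇔ f j Fin.< v
    earlier⇔ j = mk⇔ (λ (_ , <) → subst₂ Fin._<_ (at j) (insertAt-lookup f last v) <)
                     (λ < → punchIn-fromℕ-< j , subst₂ Fin._<_ (sym (at j)) (sym (insertAt-lookup f last v)) <)

count-punchIn-< : ∀ n (v : Fin (suc n)) → count (λ y → punchIn v y <? v) (allFin n) ≡ toℕ v
count-punchIn-< n       zero    = ∑ℕ.foldMap-ε (allFin n)
count-punchIn-< (suc n) (suc v) = trans (∑ℕ.foldMap-allFin-suc n (λ y → ∑ℕ.when (punchIn (suc v) y <? suc v) 1))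
                                        (cong suc (count-punchIn-< n v))

relativeRank-fromℕ : ∀ {n} (v : Fin (suc n)) (τ : Fin n → Fin n) → Injective _≡_ _≡_ τ →
                     relativeRank ((punchIn v ∘ τ) ∷ʳ v) (fromℕ n) ≡ toℕ v
relativeRank-fromℕ {n} v τ τ-inj = begin
  relativeRank ((punchIn v ∘ τ) ∷ʳ v) (fromℕ n)
    ≡⟨ relativeRank-∷ʳ-fromℕ (punchIn v ∘ τ) v ⟩
  count (λ j → punchIn v (τ j) <? v) (allFin n)
    ≡⟨ ∑ℕ.foldMap-injective n τ τ-inj (λ y → ∑ℕ.when (punchIn v y <? v) 1) ⟩
  count (λ y → punchIn v y <? v) (allFin n)
    ≡⟨ count-punchIn-< n v ⟩
  toℕ v
    ∎
  where open ≡-Reasoning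

module FunctionSums {A : Set} {_∙_ : Op₂ A} {ε : A} (M : IsCommutativeMonoid _≡_ _∙_ ε) where

  open BigOp M

  -- Without function extensionality, a sum over allFuns can only be reindexed when the summand
  -- respects pointwise equality.
  Extensional : ∀ {n m} → ((Fin n → Fin m) → A) → Set
  Extensional F = ∀ {f g} → f ≗ g → F f ≡ F g

  when-inj?-cong : ∀ {n m} (F : (Fin n → Fin m) → A) → Extensional F → Extensional (λ f → when (inj? f) (F f))
  when-inj?-cong F F-ext {f} {g} f≗g =
    trans (when-⇔ (injective-≗ f≗g) (inj? f) (inj? g) (F f)) (cong (when (inj? g)) (F-ext f≗g))

  foldMap-allFuns-∷ : ∀ n m (F : (Fin (suc n) → Fin m) → A) →
    foldMap F (allFuns (suc n) m) ≡ foldMap (λ f → foldMap (λ j → F (j ∷ᶠ f)) (allFin m)) (allFuns n m)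
  foldMap-allFuns-∷ n m F = trans (foldMap-concatMap F (λ f → map (_∷ᶠ f) (allFin m)) (allFuns n m))
                                  (foldMap-cong (λ f → foldMap-map F (_∷ᶠ f) (allFin m)) (allFuns n m))

  foldMap-allFuns-∷ʳ : ∀ n m (F : (Fin (suc n) → Fin m) → A) → Extensional F →
    foldMap F (allFuns (suc n) m) ≡ foldMap (λ f → foldMap (λ v → F (f ∷ʳ v)) (allFin m)) (allFuns n m)
  foldMap-allFuns-∷ʳ zero    m F F-ext = trans (foldMap-allFuns-∷ zero m F)
    (cong (_∙ ε) (foldMap-cong (λ j → F-ext (λ { zero → refl })) (allFin m)))
  foldMap-allFuns-∷ʳ (suc n) m F F-ext = begin
    foldMap F (allFuns (suc (suc n)) m)
      ≡⟨ foldMap-allFuns-∷ (suc n) m F ⟩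
    foldMap (λ f → foldMap (λ j → F (j ∷ᶠ f)) (allFin m)) (allFuns (suc n) m)
      ≡⟨ foldMap-allFuns-∷ʳ n m _ (λ f≗g → foldMap-cong (λ j → F-ext (∷ᶠ-cong j f≗g)) (allFin m)) ⟩
    foldMap (λ g → foldMap (λ v → foldMap (λ j → F (j ∷ᶠ (g ∷ʳ v))) (allFin m)) (allFin m)) (allFuns n m)
      ≡⟨ foldMap-cong (λ g → foldMap-comm (λ v j → F (j ∷ᶠ (g ∷ʳ v))) (allFin m) (allFin m)) (allFuns n m) ⟩
    foldMap (λ g → foldMap (λ j → foldMap (λ v → F (j ∷ᶠ (g ∷ʳ v))) (allFin m)) (allFin m)) (allFuns n m)
      ≡⟨ foldMap-cong (λ g → foldMap-cong (λ j → foldMap-cong (λ v → F-ext ∷ᶠ-∷ʳ) (allFin m)) (allFin m))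
                      (allFuns n m) ⟩
    foldMap (λ g → foldMap (λ j → foldMap (λ v → F ((j ∷ᶠ g) ∷ʳ v)) (allFin m)) (allFin m)) (allFuns n m)
      ≡⟨ foldMap-allFuns-∷ n m (λ f → foldMap (λ v → F (f ∷ʳ v)) (allFin m)) ⟨
    foldMap (λ f → foldMap (λ v → F (f ∷ʳ v)) (allFin m)) (allFuns (suc n) m)
      ∎
    where
    open ≡-Reasoning
    ∷ᶠ-∷ʳ : ∀ {j g v} → (j ∷ᶠ (g ∷ʳ v)) ≗ ((j ∷ᶠ g) ∷ʳ v)
    ∷ᶠ-∷ʳ zero    = refl
    ∷ᶠ-∷ʳ (suc x) = refl

  when-avoids?-∷ᶠ : ∀ {a m} (v : Fin m) (j : Fin m) (f : Fin a → Fin m) (x : A) →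
                    when (avoids? v (j ∷ᶠ f)) x ≡ when (avoids? v f) (when (¬? (j ≟ v)) x)
  when-avoids?-∷ᶠ v j f x = trans
    (when-⇔ (mk⇔ (λ av → (av ∘ suc) , av zero) (λ (av , j≢v) → λ { zero → j≢v ; (suc i) → av i }))
            (avoids? v (j ∷ᶠ f)) (avoids? v f ×-dec ¬? (j ≟ v)) x)
    (when-×-dec (avoids? v f) (¬? (j ≟ v)) x)

  foldMap-allFuns-avoids : ∀ a m (v : Fin (suc m)) (H : (Fin a → Fin (suc m)) → A) → Extensional H →
    foldMap (λ f → when (avoids? v f) (H f)) (allFuns a (suc m)) ≡ foldMap (λ τ → H (punchIn v ∘ τ)) (allFuns a m)
  foldMap-allFuns-avoids zero    m v H H-ext = cong (_∙ ε) (empty _ _)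
    where
    empty : (f : Fin 0 → Fin (suc m)) (τ : Fin 0 → Fin m) → when (avoids? v f) (H f) ≡ H (punchIn v ∘ τ)
    empty f τ = trans (when-yes (λ ()) (avoids? v f) (H f)) (H-ext (λ ()))
  foldMap-allFuns-avoids (suc a) m v H H-ext = begin
    foldMap (λ f → when (avoids? v f) (H f)) (allFuns (suc a) (suc m))
      ≡⟨ foldMap-allFuns-∷ a (suc m) _ ⟩
    foldMap (λ f → foldMap (λ j → when (avoids? v (j ∷ᶠ f)) (H (j ∷ᶠ f))) (allFin (suc m))) (allFuns a (suc m))
      ≡⟨ foldMap-cong pull-out-avoids (allFuns a (suc m)) ⟩
    foldMap (λ f → when (avoids? v f) (H′ f)) (allFuns a (suc m))
      ≡⟨ foldMap-allFuns-avoids a m v H′ H′-ext ⟩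
    foldMap (λ τ → H′ (punchIn v ∘ τ)) (allFuns a m)
      ≡⟨ foldMap-cong drop-v (allFuns a m) ⟩
    foldMap (λ τ → foldMap (λ k → H (punchIn v ∘ (k ∷ᶠ τ))) (allFin m)) (allFuns a m)
      ≡⟨ foldMap-allFuns-∷ a m (λ τ → H (punchIn v ∘ τ)) ⟨
    foldMap (λ τ → H (punchIn v ∘ τ)) (allFuns (suc a) m)
      ∎
    where
    open ≡-Reasoning
    H′ : (Fin a → Fin (suc m)) → A
    H′ f = foldMap (λ j → when (¬? (j ≟ v)) (H (j ∷ᶠ f))) (allFin (suc m))
    H′-ext : Extensional H′
    H′-ext f≗g = foldMap-cong (λ j → cong (when (¬? (j ≟ v))) (H-ext (∷ᶠ-cong j f≗g))) (allFin (suc m))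
    pull-out-avoids : ∀ f → foldMap (λ j → when (avoids? v (j ∷ᶠ f)) (H (j ∷ᶠ f))) (allFin (suc m))
                            ≡ when (avoids? v f) (H′ f)
    pull-out-avoids f = trans (foldMap-cong (λ j → when-avoids?-∷ᶠ v j f (H (j ∷ᶠ f))) (allFin (suc m)))
                              (foldMap-when (avoids? v f) _ (allFin (suc m)))
    punchIn-∷ᶠ : ∀ k τ → (punchIn v k ∷ᶠ (punchIn v ∘ τ)) ≗ (punchIn v ∘ (k ∷ᶠ τ))
    punchIn-∷ᶠ k τ zero    = refl
    punchIn-∷ᶠ k τ (suc x) = refl
    drop-v : ∀ τ → H′ (punchIn v ∘ τ) ≡ foldMap (λ k → H (punchIn v ∘ (k ∷ᶠ τ))) (allFin m)
    drop-v τ = trans (foldMap-when-≢ m v (λ j → H (j ∷ᶠ (punchIn v ∘ τ))))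
                     (foldMap-cong (λ k → H-ext (punchIn-∷ᶠ k τ)) (allFin m))

module PermutationSums {R : Set} {_+_ _*_ : Op₂ R} {0# 1# : R} (S : IsCommutativeSemiring _≡_ _+_ _*_ 0# 1#) where

  open IsCommutativeSemiring S
    using (+-isCommutativeMonoid; *-isCommutativeMonoid; distribˡ; distribʳ; zeroˡ; zeroʳ; +-identityʳ)
  open FunctionSums +-isCommutativeMonoid
  module ∑ = BigOp +-isCommutativeMonoid
  module ∏ = BigOp *-isCommutativeMonoid

  ∑-*ˡ : ∀ {B : Set} (c : R) (f : B → R) (xs : List B) → c * ∑.foldMap f xs ≡ ∑.foldMap (λ x → c * f x) xs
  ∑-*ˡ c f []       = zeroʳ c
  ∑-*ˡ c f (x ∷ xs) = trans (distribˡ c (f x) (∑.foldMap f xs)) (cong (_+_ (c * f x)) (∑-*ˡ c f xs))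

  ∑-*ʳ : ∀ {B : Set} (c : R) (f : B → R) (xs : List B) → ∑.foldMap f xs * c ≡ ∑.foldMap (λ x → f x * c) xs
  ∑-*ʳ c f []       = zeroˡ c
  ∑-*ʳ c f (x ∷ xs) = trans (distribʳ c (f x) (∑.foldMap f xs)) (cong (_+_ (f x * c)) (∑-*ʳ c f xs))

  when-*ˡ : ∀ {P : Set} (c : R) (d : Dec P) (x : R) → c * ∑.when d x ≡ ∑.when d (c * x)
  when-*ˡ c (yes _) x = refl
  when-*ˡ c (no _)  x = zeroʳ c

  weight : ∀ {n m} → (Fin n → ℕ → R) → (Fin n → Fin m) → R
  weight {n} g f = ∏.foldMap (λ i → g i (relativeRank f i)) (allFin n)

  weight-cong : ∀ {n m} (g : Fin n → ℕ → R) → Extensional (weight {n} {m} g)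
  weight-cong {n} g f≗f′ = ∏.foldMap-cong (λ i → cong (g i) (relativeRank-cong f≗f′ i)) (allFin n)

  injWeight : ∀ {n m} → (Fin n → ℕ → R) → (Fin n → Fin m) → R
  injWeight g f = ∑.when (inj? f) (weight g f)

  ∑perms≡∑injWeight : ∀ n (g : Fin n → ℕ → R) →
                      ∑.foldMap (weight g) (perms n) ≡ ∑.foldMap (injWeight g) (allFuns n n)
  ∑perms≡∑injWeight n g =
    trans (∑.foldMap-filter injective? (weight g) (allFuns n n)) (∑.foldMap-cong same-test (allFuns n n))
    where
    same-test : ∀ σ → ∑.when (injective? σ) (weight g σ) ≡ injWeight g σ
    same-test σ = ∑.when-⇔ (mk⇔ (λ inj {i} {j} → inj i j) (λ inj i j → inj)) (injective? σ) (inj? σ) (weight g σ)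

  weight-∷ʳ : ∀ {n} (g : Fin (suc n) → ℕ → R) (v : Fin (suc n)) (τ : Fin n → Fin n) → Injective _≡_ _≡_ τ →
              weight g ((punchIn v ∘ τ) ∷ʳ v) ≡ g (fromℕ n) (toℕ v) * weight (g ∘ punchIn (fromℕ n)) τ
  weight-∷ʳ {n} g v τ τ-inj = trans (∏.foldMap-punchIn n (fromℕ n) _)
    (cong₂ _*_ (cong (g (fromℕ n)) (relativeRank-fromℕ v τ τ-inj))
               (∏.foldMap-cong (λ j → cong (g (punchIn (fromℕ n) j)) (earlier j)) (allFin n)))
    where
    earlier : ∀ j → relativeRank ((punchIn v ∘ τ) ∷ʳ v) (punchIn (fromℕ n) j) ≡ relativeRank τ j
    earlier j = trans (relativeRank-∷ʳ-punchIn (punchIn v ∘ τ) v j) (relativeRank-punchIn-∘ v τ j)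

  ∑injWeight-∷ʳ : ∀ n (g : Fin (suc n) → ℕ → R) (v : Fin (suc n)) →
    ∑.foldMap (λ f → injWeight g (f ∷ʳ v)) (allFuns n (suc n))
      ≡ g (fromℕ n) (toℕ v) * ∑.foldMap (weight (g ∘ punchIn (fromℕ n))) (perms n)
  ∑injWeight-∷ʳ n g v = begin
    ∑.foldMap (λ f → injWeight g (f ∷ʳ v)) (allFuns n (suc n))
      ≡⟨ ∑.foldMap-cong split-injective (allFuns n (suc n)) ⟩
    ∑.foldMap (λ f → ∑.when (avoids? v f) (H f)) (allFuns n (suc n))
      ≡⟨ foldMap-allFuns-avoids n n v H (when-inj?-cong _ (weight-cong g ∘ insertAt-cong (fromℕ n) v)) ⟩
    ∑.foldMap (λ τ → H (punchIn v ∘ τ)) (allFuns n n)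
      ≡⟨ ∑.foldMap-cong factor-last (allFuns n n) ⟩
    ∑.foldMap (λ τ → c * injWeight g′ τ) (allFuns n n)
      ≡⟨ ∑-*ˡ c (injWeight g′) (allFuns n n) ⟨
    c * ∑.foldMap (injWeight g′) (allFuns n n)
      ≡⟨ cong (c *_) (∑perms≡∑injWeight n g′) ⟨
    c * ∑.foldMap (weight g′) (perms n)
      ∎
    where
    open ≡-Reasoning
    c = g (fromℕ n) (toℕ v)
    g′ = g ∘ punchIn (fromℕ n)
    H : (Fin n → Fin (suc n)) → R
    H f = ∑.when (inj? f) (weight g (f ∷ʳ v))
    split-injective : ∀ f → injWeight g (f ∷ʳ v) ≡ ∑.when (avoids? v f) (H f)
    split-injective f = trans
      (∑.when-⇔ (insertAt-injective⇔ f (fromℕ n) v) (inj? (f ∷ʳ v)) (avoids? v f ×-dec inj? f) (weight g (f ∷ʳ v)))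
      (∑.when-×-dec (avoids? v f) (inj? f) (weight g (f ∷ʳ v)))
    factor-last : ∀ τ → H (punchIn v ∘ τ) ≡ c * injWeight g′ τ
    factor-last τ = begin
      ∑.when (inj? (punchIn v ∘ τ)) (weight g ((punchIn v ∘ τ) ∷ʳ v))
        ≡⟨ ∑.when-⇔ (punchIn-∘-injective⇔ v τ) (inj? (punchIn v ∘ τ)) (inj? τ) _ ⟩
      ∑.when (inj? τ) (weight g ((punchIn v ∘ τ) ∷ʳ v))
        ≡⟨ ∑.when-cong (inj? τ) (weight-∷ʳ g v τ) ⟩
      ∑.when (inj? τ) (c * weight g′ τ)
        ≡⟨ when-*ˡ c (inj? τ) (weight g′ τ) ⟨
      c * injWeight g′ τ
        ∎

  ∏∑-split-last : ∀ n (g : Fin (suc n) → ℕ → R) →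
    ∏.foldMap (λ i → ∑.foldMap< (suc (toℕ i)) (g i)) (allFin (suc n))
      ≡ ∑.foldMap< (suc n) (g (fromℕ n))
        * ∏.foldMap (λ j → ∑.foldMap< (suc (toℕ j)) (g (punchIn (fromℕ n) j))) (allFin n)
  ∏∑-split-last n g = trans (∏.foldMap-punchIn n (fromℕ n) _)
    (cong₂ _*_ (cong (λ t → ∑.foldMap< (suc t) (g (fromℕ n))) (toℕ-fromℕ n))
               (∏.foldMap-cong (λ j → cong (λ t → ∑.foldMap< (suc t) (g (punchIn (fromℕ n) j)))
                                           (toℕ-punchIn-fromℕ j))
                               (allFin n)))

  ∑perms-weight≡∏∑ : ∀ n (g : Fin n → ℕ → R) →
    ∑.foldMap (weight g) (perms n) ≡ ∏.foldMap (λ i → ∑.foldMap< (suc (toℕ i)) (g i)) (allFin n)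
  ∑perms-weight≡∏∑ zero    g = +-identityʳ 1#
  ∑perms-weight≡∏∑ (suc n) g = begin
    ∑.foldMap (weight g) (perms (suc n))
      ≡⟨ ∑perms≡∑injWeight (suc n) g ⟩
    ∑.foldMap (injWeight g) (allFuns (suc n) (suc n))
      ≡⟨ foldMap-allFuns-∷ʳ n (suc n) (injWeight g) (when-inj?-cong (weight g) (weight-cong g)) ⟩
    ∑.foldMap (λ f → ∑.foldMap (λ v → injWeight g (f ∷ʳ v)) (allFin (suc n))) (allFuns n (suc n))
      ≡⟨ ∑.foldMap-comm (λ f v → injWeight g (f ∷ʳ v)) (allFuns n (suc n)) (allFin (suc n)) ⟩
    ∑.foldMap (λ v → ∑.foldMap (λ f → injWeight g (f ∷ʳ v)) (allFuns n (suc n))) (allFin (suc n))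
      ≡⟨ ∑.foldMap-cong (∑injWeight-∷ʳ n g) (allFin (suc n)) ⟩
    ∑.foldMap (λ v → g (fromℕ n) (toℕ v) * ∑.foldMap (weight g′) (perms n)) (allFin (suc n))
      ≡⟨ ∑-*ʳ _ (g (fromℕ n) ∘ toℕ) (allFin (suc n)) ⟨
    ∑.foldMap< (suc n) (g (fromℕ n)) * ∑.foldMap (weight g′) (perms n)
      ≡⟨ cong (∑.foldMap< (suc n) (g (fromℕ n)) *_) (∑perms-weight≡∏∑ n g′) ⟩
    ∑.foldMap< (suc n) (g (fromℕ n)) * ∏.foldMap (λ j → ∑.foldMap< (suc (toℕ j)) (g′ j)) (allFin n)
      ≡⟨ ∏∑-split-last n g ⟨
    ∏.foldMap (λ i → ∑.foldMap< (suc (toℕ i)) (g i)) (allFin (suc n))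
      ∎
    where
    open ≡-Reasoning
    g′ = g ∘ punchIn (fromℕ n)

module Permℕ = PermutationSums ℕP.+-*-isCommutativeSemiring

∏<suc≡! : ∀ n → ∏ℕ.foldMap< n suc ≡ n !
∏<suc≡! zero    = refl
∏<suc≡! (suc n) = trans (∏ℕ.foldMap<-suc n suc) (cong (suc n ℕ.*_) (∏<suc≡! n))

length-perms : ∀ n → length (perms n) ≡ n !
length-perms n = begin
  length (perms n)
    ≡⟨ length≡∑1 (perms n) ⟩
  ∑ℕ.foldMap (λ _ → 1) (perms n)
    ≡⟨ ∑ℕ.foldMap-cong (λ _ → sym (∏ℕ.foldMap-ε (allFin n))) (perms n) ⟩
  ∑ℕ.foldMap (Permℕ.weight (λ _ _ → 1)) (perms n)
    ≡⟨ Permℕ.∑perms-weight≡∏∑ n (λ _ _ → 1) ⟩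
  ∏ℕ.foldMap (λ i → ∑ℕ.foldMap< (suc (toℕ i)) (λ _ → 1)) (allFin n)
    ≡⟨ ∏ℕ.foldMap-cong ∑<1 (allFin n) ⟩
  ∏ℕ.foldMap< n suc
    ≡⟨ ∏<suc≡! n ⟩
  n !
    ∎
  where
  open ≡-Reasoning
  ∑<1 : ∀ (i : Fin n) → ∑ℕ.foldMap< (suc (toℕ i)) (λ _ → 1) ≡ suc (toℕ i)
  ∑<1 i = trans (sym (length≡∑1 (allFin (suc (toℕ i))))) (length-tabulate id)

overlapLength : ℕ → ℕ → ℕ → ℕ → ℕ
overlapLength a b lo hi = (b ⊓ hi) ∸ (a ⊔ lo)

clamp : ℕ → ℕ → ℕ → ℕ
clamp lo hi x = (lo ⊔ x) ⊓ hi

clamp-mono : ∀ lo hi {x y} → x ≤ y → clamp lo hi x ≤ clamp lo hi y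
clamp-mono lo hi x≤y = ℕP.⊓-monoˡ-≤ hi (ℕP.⊔-monoʳ-≤ lo x≤y)

module _ {lo hi : ℕ} where

  clamp-≥ : ∀ {x} → hi ≤ x → clamp lo hi x ≡ hi
  clamp-≥ {x} hi≤x = ℕP.m≥n⇒m⊓n≡n (ℕP.≤-trans hi≤x (ℕP.m≤n⊔m lo x))

  clamp-≤ : ∀ {x} → lo ≤ hi → x ≤ lo → clamp lo hi x ≡ lo
  clamp-≤ lo≤hi x≤lo = trans (cong (_⊓ hi) (ℕP.m≥n⇒m⊔n≡m x≤lo)) (ℕP.m≤n⇒m⊓n≡m lo≤hi)

  clamp-≥lo : ∀ {x} → lo ≤ x → clamp lo hi x ≡ x ⊓ hi
  clamp-≥lo lo≤x = cong (_⊓ hi) (ℕP.m≤n⇒m⊔n≡n lo≤x)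

  clamp-≤hi : ∀ {x} → lo ≤ hi → x ≤ hi → clamp lo hi x ≡ x ⊔ lo
  clamp-≤hi {x} lo≤hi x≤hi = trans (ℕP.m≤n⇒m⊓n≡m (ℕP.⊔-lub lo≤hi x≤hi)) (ℕP.⊔-comm lo x)

  overlapLength≡clamp∸clamp : ∀ {a b} → a ≤ b → lo ≤ hi →
                              overlapLength a b lo hi ≡ clamp lo hi b ∸ clamp lo hi a
  overlapLength≡clamp∸clamp {a} {b} a≤b lo≤hi with hi ℕ.≤? a | b ℕ.≤? lo
  ... | yes hi≤a | _ = begin
    overlapLength a b lo hi
      ≡⟨ ℕP.m≤n⇒m∸n≡0 (ℕP.≤-trans (ℕP.m⊓n≤n b hi) (ℕP.≤-trans hi≤a (ℕP.m≤m⊔n a lo))) ⟩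
    0
      ≡⟨ ℕP.n∸n≡0 hi ⟨
    hi ∸ hi
      ≡⟨ cong₂ _∸_ (clamp-≥ (ℕP.≤-trans hi≤a a≤b)) (clamp-≥ hi≤a) ⟨
    clamp lo hi b ∸ clamp lo hi a
      ∎
    where open ≡-Reasoning
  ... | no _ | yes b≤lo = begin
    overlapLength a b lo hi
      ≡⟨ ℕP.m≤n⇒m∸n≡0 (ℕP.≤-trans (ℕP.m⊓n≤m b hi) (ℕP.≤-trans b≤lo (ℕP.m≤n⊔m a lo))) ⟩
    0
      ≡⟨ ℕP.n∸n≡0 lo ⟨
    lo ∸ lo
      ≡⟨ cong₂ _∸_ (clamp-≤ lo≤hi b≤lo) (clamp-≤ lo≤hi (ℕP.≤-trans a≤b b≤lo)) ⟨
    clamp lo hi b ∸ clamp lo hi a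
      ∎
    where open ≡-Reasoning
  ... | no hi≰a | no b≰lo =
    sym (cong₂ _∸_ (clamp-≥lo (ℕP.<⇒≤ (ℕP.≰⇒> b≰lo))) (clamp-≤hi lo≤hi (ℕP.<⇒≤ (ℕP.≰⇒> hi≰a))))

y∸x+z∸y≡z∸x : ∀ {x y z} → x ≤ y → y ≤ z → (y ∸ x) ℕ.+ (z ∸ y) ≡ z ∸ x
y∸x+z∸y≡z∸x {x} {y} {z} x≤y y≤z = begin
  (y ∸ x) ℕ.+ (z ∸ y)   ≡⟨ ℕP.+-comm (y ∸ x) (z ∸ y) ⟩
  (z ∸ y) ℕ.+ (y ∸ x)   ≡⟨ ℕP.+-∸-assoc (z ∸ y) x≤y ⟨
  (z ∸ y) ℕ.+ y ∸ x     ≡⟨ cong (_∸ x) (ℕP.m∸n+n≡m y≤z) ⟩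
  z ∸ x                 ∎
  where open ≡-Reasoning

∑-telescope : (c : ℕ → ℕ) → (∀ {r s} → r ≤ s → c r ≤ c s) → ∀ t →
              ∑ℕ.foldMap< t (λ r → c (suc r) ∸ c r) ≡ c t ∸ c 0
∑-telescope c c-mono zero    = sym (ℕP.n∸n≡0 (c 0))
∑-telescope c c-mono (suc t) = begin
  ∑ℕ.foldMap< (suc t) (λ r → c (suc r) ∸ c r)
    ≡⟨ ∑ℕ.foldMap-allFin-suc t _ ⟩
  (c 1 ∸ c 0) ℕ.+ ∑ℕ.foldMap< t (λ r → c (suc (suc r)) ∸ c (suc r))
    ≡⟨ cong ((c 1 ∸ c 0) ℕ.+_) (∑-telescope (c ∘ suc) (c-mono ∘ ℕ.s≤s) t) ⟩
  (c 1 ∸ c 0) ℕ.+ (c (suc t) ∸ c 1)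
    ≡⟨ y∸x+z∸y≡z∸x (c-mono ℕ.z≤n) (c-mono (ℕ.s≤s ℕ.z≤n)) ⟩
  c (suc t) ∸ c 0
    ∎
  where open ≡-Reasoning

∑overlapLength≡hi∸lo : ∀ N t {lo hi} → lo ≤ hi → hi ≤ t ℕ.* N →
  ∑ℕ.foldMap< t (λ r → overlapLength (r ℕ.* N) (suc r ℕ.* N) lo hi) ≡ hi ∸ lo
∑overlapLength≡hi∸lo N t {lo} {hi} lo≤hi hi≤tN = begin
  ∑ℕ.foldMap< t (λ r → overlapLength (r ℕ.* N) (suc r ℕ.* N) lo hi)
    ≡⟨ ∑ℕ.foldMap-cong (λ r → overlapLength≡clamp∸clamp (ℕP.m≤n+m (toℕ r ℕ.* N) N) lo≤hi) (allFin t) ⟩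
  ∑ℕ.foldMap< t (λ r → clamp lo hi (suc r ℕ.* N) ∸ clamp lo hi (r ℕ.* N))
    ≡⟨ ∑-telescope (λ r → clamp lo hi (r ℕ.* N)) (clamp-mono lo hi ∘ ℕP.*-monoˡ-≤ N) t ⟩
  clamp lo hi (t ℕ.* N) ∸ clamp lo hi 0
    ≡⟨ cong₂ _∸_ (clamp-≥ hi≤tN) (clamp-≤ lo≤hi ℕ.z≤n) ⟩
  hi ∸ lo
    ∎
  where open ≡-Reasoning

∑ceilNumerator≡t : ∀ N t k → k ℕ.< N →
  ∑ℕ.foldMap< t (λ r → overlapLength (r ℕ.* N) (suc r ℕ.* N) (k ℕ.* t) (suc k ℕ.* t)) ≡ t
∑ceilNumerator≡t N t k k<N =
  trans (∑overlapLength≡hi∸lo N t (ℕP.m≤n+m (k ℕ.* t) t) hi≤tN) (ℕP.m+n∸n≡m t (k ℕ.* t))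
  where
  hi≤tN : suc k ℕ.* t ≤ t ℕ.* N
  hi≤tN = subst (suc k ℕ.* t ≤_) (ℕP.*-comm N t) (ℕP.*-monoˡ-≤ t k<N)

fromℚᵘ-homo-+ : ∀ p q → fromℚᵘ (p ℚᵘ.+ q) ≡ fromℚᵘ p ℚ.+ fromℚᵘ q
fromℚᵘ-homo-+ p q = begin
  fromℚᵘ (p ℚᵘ.+ q)
    ≡⟨ fromℚᵘ-cong (ℚᵘP.+-cong (ℚᵘP.≃-sym (toℚᵘ-fromℚᵘ p)) (ℚᵘP.≃-sym (toℚᵘ-fromℚᵘ q))) ⟩
  fromℚᵘ (toℚᵘ (fromℚᵘ p) ℚᵘ.+ toℚᵘ (fromℚᵘ q))
    ≡⟨ fromℚᵘ-cong (ℚᵘP.≃-sym (toℚᵘ-homo-+ (fromℚᵘ p) (fromℚᵘ q))) ⟩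
  fromℚᵘ (toℚᵘ (fromℚᵘ p ℚ.+ fromℚᵘ q))
    ≡⟨ fromℚᵘ-toℚᵘ _ ⟩
  fromℚᵘ p ℚ.+ fromℚᵘ q
    ∎
  where open ≡-Reasoning

fromℚᵘ-homo-* : ∀ p q → fromℚᵘ (p ℚᵘ.* q) ≡ fromℚᵘ p ℚ.* fromℚᵘ q
fromℚᵘ-homo-* p q = begin
  fromℚᵘ (p ℚᵘ.* q)
    ≡⟨ fromℚᵘ-cong (ℚᵘP.*-cong (ℚᵘP.≃-sym (toℚᵘ-fromℚᵘ p)) (ℚᵘP.≃-sym (toℚᵘ-fromℚᵘ q))) ⟩
  fromℚᵘ (toℚᵘ (fromℚᵘ p) ℚᵘ.* toℚᵘ (fromℚᵘ q))
    ≡⟨ fromℚᵘ-cong (ℚᵘP.≃-sym (toℚᵘ-homo-* (fromℚᵘ p) (fromℚᵘ q))) ⟩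
  fromℚᵘ (toℚᵘ (fromℚᵘ p ℚ.* fromℚᵘ q))
    ≡⟨ fromℚᵘ-toℚᵘ _ ⟩
  fromℚᵘ p ℚ.* fromℚᵘ q
    ∎
  where open ≡-Reasoning

a/n+b/n≡[a+b]/n : ∀ a b n .{{_ : NonZero n}} → ((+ a) / n) ℚ.+ ((+ b) / n) ≡ (+ (a ℕ.+ b)) / n
a/n+b/n≡[a+b]/n a b zero {{n≢0}} = ⊥-elim (≢-nonZero⁻¹ zero {{n≢0}} refl)
a/n+b/n≡[a+b]/n a b n@(suc n-1) = trans (sym (fromℚᵘ-homo-+ a/n b/n))
  (fromℚᵘ-cong {a/n ℚᵘ.+ b/n} {mkℚᵘ (+ (a ℕ.+ b)) n-1} (*≡* (begin
    (+ a ℤ.* + n ℤ.+ + b ℤ.* + n) ℤ.* + n ≡⟨ cong (ℤ._* + n) (ℤP.*-distribʳ-+ (+ n) (+ a) (+ b)) ⟨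
    (+ a ℤ.+ + b) ℤ.* + n ℤ.* + n         ≡⟨ ℤP.*-assoc (+ a ℤ.+ + b) (+ n) (+ n) ⟩
    (+ a ℤ.+ + b) ℤ.* (+ n ℤ.* + n)       ≡⟨ cong₂ ℤ._*_ (ℤP.pos-+ a b) (ℤP.pos-* n n) ⟨
    + (a ℕ.+ b) ℤ.* + (n ℕ.* n)           ∎)))
  where
  open ≡-Reasoning
  a/n = mkℚᵘ (+ a) n-1
  b/n = mkℚᵘ (+ b) n-1

a/b*c/d≡[a*c]/[b*d] : ∀ a b c d .{{_ : NonZero b}} .{{_ : NonZero d}} →
                      ((+ a) / b) ℚ.* ((+ c) / d) ≡ _/_ (+ (a ℕ.* c)) (b ℕ.* d) {{m*n≢0 b d}}
a/b*c/d≡[a*c]/[b*d] a zero    c d         {{b≢0}}         = ⊥-elim (≢-nonZero⁻¹ zero {{b≢0}} refl)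
a/b*c/d≡[a*c]/[b*d] a (suc b) c zero      {{_}}   {{d≢0}} = ⊥-elim (≢-nonZero⁻¹ zero {{d≢0}} refl)
a/b*c/d≡[a*c]/[b*d] a (suc b) c (suc d) = trans (sym (fromℚᵘ-homo-* (mkℚᵘ (+ a) b) (mkℚᵘ (+ c) d)))
  (cong (_/ (suc b ℕ.* suc d)) (sym (ℤP.pos-* a c)))

[a*c]/[b*c]≡a/b : ∀ a b c .{{_ : NonZero b}} .{{_ : NonZero c}} →
                  _/_ (+ (a ℕ.* c)) (b ℕ.* c) {{m*n≢0 b c}} ≡ (+ a) / b
[a*c]/[b*c]≡a/b a zero    c       {{b≢0}}         = ⊥-elim (≢-nonZero⁻¹ zero {{b≢0}} refl)
[a*c]/[b*c]≡a/b a (suc b) zero    {{_}}   {{c≢0}} = ⊥-elim (≢-nonZero⁻¹ zero {{c≢0}} refl)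
[a*c]/[b*c]≡a/b a b@(suc b-1) c@(suc c-1) =
  fromℚᵘ-cong {mkℚᵘ (+ (a ℕ.* c)) (ℕ.pred (b ℕ.* c))} {mkℚᵘ (+ a) b-1} (*≡* (begin
    + (a ℕ.* c) ℤ.* + b       ≡⟨ cong (ℤ._* + b) (ℤP.pos-* a c) ⟩
    + a ℤ.* + c ℤ.* + b       ≡⟨ ℤP.*-assoc (+ a) (+ c) (+ b) ⟩
    + a ℤ.* (+ c ℤ.* + b)     ≡⟨ cong (+ a ℤ.*_) (ℤP.*-comm (+ c) (+ b)) ⟩
    + a ℤ.* (+ b ℤ.* + c)     ≡⟨ cong (+ a ℤ.*_) (ℤP.pos-* b c) ⟨
    + a ℤ.* + (b ℕ.* c)       ∎))
  where open ≡-Reasoning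

module ∑ℚ = BigOp ℚP.+-0-isCommutativeMonoid
module ∏ℚ = BigOp ℚP.*-1-isCommutativeMonoid
module Permℚ = PermutationSums (IsCommutativeRing.isCommutativeSemiring ℚP.+-*-isCommutativeRing)

∑-/ : ∀ {B : Set} (a : B → ℕ) N .{{_ : NonZero N}} (xs : List B) →
      ∑ℚ.foldMap (λ x → (+ a x) / N) xs ≡ (+ ∑ℕ.foldMap a xs) / N
∑-/ a N []       = sym (ℚP.0/n≡0 N)
∑-/ a N (x ∷ xs) = trans (cong ((+ a x) / N ℚ.+_) (∑-/ a N xs)) (a/n+b/n≡[a+b]/n (a x) (∑ℕ.foldMap a xs) N)

∏-/ : ∀ n (a : Fin n → ℕ) N .{{_ : NonZero N}} →
      ∏ℚ.foldMap (λ i → (+ a i) / N) (allFin n) ≡ _/_ (+ ∏ℕ.foldMap a (allFin n)) (N ^ n) {{m^n≢0 N n}}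
∏-/ zero    a N = refl
∏-/ (suc n) a N {{N≢0}} = begin
  ∏ℚ.foldMap (λ i → (+ a i) / N) (allFin (suc n))
    ≡⟨ ∏ℚ.foldMap-allFin-suc n (λ i → (+ a i) / N) ⟩
  (+ a zero) / N ℚ.* ∏ℚ.foldMap (λ i → (+ a (suc i)) / N) (allFin n)
    ≡⟨ cong ((+ a zero) / N ℚ.*_) (∏-/ n (a ∘ suc) N) ⟩
  (+ a zero) / N ℚ.* _/_ (+ ∏ℕ.foldMap (a ∘ suc) (allFin n)) (N ^ n) {{m^n≢0 N n}}
    ≡⟨ a/b*c/d≡[a*c]/[b*d] (a zero) N (∏ℕ.foldMap (a ∘ suc) (allFin n)) (N ^ n) {{N≢0}} {{m^n≢0 N n}} ⟩
  _/_ (+ (a zero ℕ.* ∏ℕ.foldMap (a ∘ suc) (allFin n))) (N ^ suc n) {{m^n≢0 N (suc n)}}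
    ≡⟨ cong (λ p → _/_ (+ p) (N ^ suc n) {{m^n≢0 N (suc n)}}) (∏ℕ.foldMap-allFin-suc n a) ⟨
  _/_ (+ ∏ℕ.foldMap a (allFin (suc n))) (N ^ suc n) {{m^n≢0 N (suc n)}}
    ∎
  where open ≡-Reasoning

a/b*1/a≡1/b : ∀ a b .{{_ : NonZero a}} .{{_ : NonZero b}} → ((+ a) / b) ℚ.* ((+ 1) / a) ≡ (+ 1) / b
a/b*1/a≡1/b a b = begin
  ((+ a) / b) ℚ.* ((+ 1) / a)
    ≡⟨ a/b*c/d≡[a*c]/[b*d] a b 1 a ⟩
  _/_ (+ (a ℕ.* 1)) (b ℕ.* a) {{m*n≢0 b a}}
    ≡⟨ ℚP./-cong {{m*n≢0 b a}} {{m*n≢0 b a}} (cong +_ (ℕP.*-comm a 1)) refl ⟩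
  _/_ (+ (1 ℕ.* a)) (b ℕ.* a) {{m*n≢0 b a}}
    ≡⟨ [a*c]/[b*c]≡a/b 1 b a ⟩
  (+ 1) / b
    ∎
  where open ≡-Reasoning

avg≡sumℚ*1/L : ∀ (ys : List ℚ) L .{{_ : NonZero L}} → length ys ≡ L → avg ys ≡ sumℚ ys ℚ.* ((+ 1) / L)
avg≡sumℚ*1/L []       L {{L≢0}} []≡L = ⊥-elim (≢-nonZero⁻¹ L {{L≢0}} (sym []≡L))
avg≡sumℚ*1/L (y ∷ ys) L           eq =
  cong (sumℚ (y ∷ ys) ℚ.*_) (ℚP./-cong {+ 1} {suc (length ys)} {+ 1} {L} refl eq)

-- ceilProb (suc m) t r (suc k) unfolds to (+ overlapLength (r * suc m) (suc r * suc m) (k * t) (suc k * t)) / suc m.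
∑ceilProb≡t/N : ∀ m t k → k ℕ.< suc m → ∑ℚ.foldMap< t (λ r → ceilProb (suc m) t r (suc k)) ≡ (+ t) / suc m
∑ceilProb≡t/N m t k k<N =
  trans (∑-/ _ (suc m) (allFin t)) (cong (λ p → (+ p) / suc m) (∑ceilNumerator≡t (suc m) t k k<N))

∏∑ceilProb≡n!/Nⁿ : ∀ n m (k : Fin n → Fin (suc m)) →
  ∏ℚ.foldMap (λ i → ∑ℚ.foldMap< (suc (toℕ i)) (λ r → ceilProb (suc m) (suc (toℕ i)) r (suc (toℕ (k i)))))
             (allFin n)
    ≡ _/_ (+ (n !)) (suc m ^ n) {{m^n≢0 (suc m) n}}
∏∑ceilProb≡n!/Nⁿ n m k = begin
  ∏ℚ.foldMap (λ i → ∑ℚ.foldMap< (suc (toℕ i)) (λ r → ceilProb N (suc (toℕ i)) r (suc (toℕ (k i))))) (allFin n)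
    ≡⟨ ∏ℚ.foldMap-cong (λ i → ∑ceilProb≡t/N m (suc (toℕ i)) (toℕ (k i)) (toℕ<n (k i))) (allFin n) ⟩
  ∏ℚ.foldMap (λ i → (+ suc (toℕ i)) / N) (allFin n)
    ≡⟨ ∏-/ n (suc ∘ toℕ) N ⟩
  _/_ (+ ∏ℕ.foldMap< n suc) (N ^ n) {{m^n≢0 N n}}
    ≡⟨ cong (λ p → _/_ (+ p) (N ^ n) {{m^n≢0 N n}}) (∏<suc≡! n) ⟩
  _/_ (+ (n !)) (N ^ n) {{m^n≢0 N n}}
    ∎
  where
  open ≡-Reasoning
  N = suc m

proposition3p5 : (m : ℕ) (k : Fin (suc m) → Fin (suc m)) →
    jointProb (suc m) k ≡ _/_ (+ 1) (suc m ^ suc m) {{m^n≢0 (suc m) (suc m)}}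
proposition3p5 m k = begin
  jointProb N k
    ≡⟨ avg≡sumℚ*1/L (map (Permℚ.weight g) (perms N)) (N !) (trans (length-map _ (perms N)) (length-perms N)) ⟩
  ∑ℚ.foldMap (Permℚ.weight g) (perms N) ℚ.* ((+ 1) / N !)
    ≡⟨ cong (ℚ._* ((+ 1) / N !)) (Permℚ.∑perms-weight≡∏∑ N g) ⟩
  ∏ℚ.foldMap (λ i → ∑ℚ.foldMap< (suc (toℕ i)) (g i)) (allFin N) ℚ.* ((+ 1) / N !)
    ≡⟨ cong (ℚ._* ((+ 1) / N !)) (∏∑ceilProb≡n!/Nⁿ N m k) ⟩
  ((+ (N !)) / (N ^ N)) ℚ.* ((+ 1) / N !)
    ≡⟨ a/b*1/a≡1/b (N !) (N ^ N) ⟩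
  (+ 1) / (N ^ N)
    ∎
  where
  open ≡-Reasoning
  N = suc m
  g : Fin N → ℕ → ℚ
  g i r = ceilProb N (suc (toℕ i)) r (suc (toℕ (k i)))
  instance
    N!≢0 : NonZero (N !)
    N!≢0 = N !≢0
    N^N≢0 : NonZero (N ^ N)
    N^N≢0 = m^n≢0 N N
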